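{- Let $n>c_1\ge c_2$ be natural numbers. If every sequence in $\mathcal D(n,c_1,c_2)$ is graphic, then for every $k\in\{1,\dots,n\}$ we have $c_1k\le k(k-1)+c_2(n-k)+1$.
   Context: $\mathcal D(n,c_1,c_2)$ is the set of integer sequences $(d_1,\dots,d_n)$ with $c_1\ge d_1\ge\dots\ge d_n\ge c_2$ and $\sum_i d_i$ even. A sequence is graphic if it is the degree sequence of a simple graph on $n$ labelled vertices. -}

module Defs where

open import Data.Nat using (ℕ; _+_; _*_; _∸_; _≤_; _≥_)
open import Data.Nat.Divisibility using (_∣_)
open import Data.Bool using (Bool; true; false; if_then_else_)
open import Data.Fin using (Fin)
open import Data.List using (List; map; allFin)
open import Data.Nat.ListAction using (sum)
open import Data.Product using (Σ; _×_)
open import Relation.Binary.PropositionalEquality using (_≡_)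

record SimpleGraph (n : ℕ) : Set where
  field
    adj   : Fin n → Fin n → Bool
    sym   : ∀ i j → adj i j ≡ adj j i
    irrefl : ∀ i → adj i i ≡ false

open SimpleGraph public

degree : {n : ℕ} → SimpleGraph n → Fin n → ℕ
degree {n} G i = sum (map (λ j → if adj G i j then 1 else 0) (allFin n))

seqSum : {n : ℕ} → (Fin n → ℕ) → ℕ
seqSum {n} d = sum (map d (allFin n))

Graphic : {n : ℕ} → (Fin n → ℕ) → Set
Graphic {n} d = Σ (SimpleGraph n) (λ G → ∀ i → degree G i ≡ d i)

NonIncreasing : {n : ℕ} → (Fin n → ℕ) → Set
NonIncreasing {n} d = ∀ (i : Fin n) (j : Fin n) → Data.Fin._≤_ i j → d j ≤ d i

InD : (n c₁ c₂ : ℕ) → (Fin n → ℕ) → Set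
InD n c₁ c₂ d =
  NonIncreasing d × (∀ i → d i ≤ c₁) × (∀ i → c₂ ≤ d i) × (2 ∣ seqSum d)

-- Write n = k + m. In a simple graph the first k vertices have degree sum at
-- most k(k-1), for the edges among themselves, plus the degree sum of the other
-- m vertices, for the edges leaving them.  When c₂ < c₁ and m ≥ 1, apply this to
-- the staircase (c₁^k, c₂ + e, c₂^(m-1)) of 𝒟(n,c₁,c₂), where e ∈ {0,1} fixes the
-- parity of the sum: c₁k ≤ k(k-1) + c₂m + e.  Otherwise c₁m = c₂m, 𝒟(n,c₁,c₂)
-- may be empty, and the bound follows from c₁ < n alone.

module Submission where

open import Defs
open import Data.Nat using (ℕ; _+_; _*_; _∸_; _≤_; _<_)
open import Data.Fin using (Fin)
open import Data.Nat using (zero; suc; z≤n; _≤?_)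
open import Data.Nat.Properties
open import Data.Nat.DivMod using (_/_; _%_; m≡m%n+[m/n]*n; m%n<n)
open import Data.Nat.Divisibility using (_∣_; divides)
open import Data.Nat.Tactic.RingSolver using (solve-∀)
import Data.Nat.ListAction as List
open import Data.Fin using (zero; suc; toℕ; splitAt; _↑ˡ_; _↑ʳ_; punchIn)
open import Data.Fin.Properties using (toℕ<n; toℕ-↑ˡ; toℕ-↑ʳ; splitAt⁻¹-↑ˡ; splitAt⁻¹-↑ʳ)
open import Data.Bool using (true; false; if_then_else_)
open import Data.List using (tabulate)
open import Data.List.Properties using (map-tabulate)
open import Data.Vec.Functional using (Vector; _++_; replicate; removeAt)
open import Data.Vec.Functional.Properties using (lookup-++ˡ; lookup-++ʳ)
open import Algebra.Properties.CommutativeMonoid.Sum +-0-commutativeMonoid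
  using (sum; sum-syntax; sum-cong-≗; ∑-distrib-+; ∑-comm; sum-remove)
open import Data.Product using (_,_)
open import Data.Sum using (inj₁; inj₂)
open import Function using (id; _∘_)
open import Relation.Nullary using (yes; no; contradiction)
open import Relation.Binary.PropositionalEquality
  using (_≡_; refl; trans; cong; cong₂; subst; subst₂)
import Relation.Binary.PropositionalEquality as ≡

sum-mono-≤ : ∀ {n} {f g : Vector ℕ n} → (∀ i → f i ≤ g i) → sum f ≤ sum g
sum-mono-≤ {zero}  f≤g = z≤n
sum-mono-≤ {suc n} f≤g = +-mono-≤ (f≤g zero) (sum-mono-≤ (f≤g ∘ suc))

sum-replicate : ∀ n x → sum (replicate n x) ≡ n * x
sum-replicate zero    x = refl
sum-replicate (suc n) x = cong (x +_) (sum-replicate n x)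

sum-↑ : ∀ k m (f : Vector ℕ (k + m)) →
        sum f ≡ ∑[ i < k ] f (i ↑ˡ m) + ∑[ j < m ] f (k ↑ʳ j)
sum-↑ zero    m f = refl
sum-↑ (suc k) m f = trans (cong (f zero +_) (sum-↑ k m (f ∘ suc))) (≡.sym (+-assoc (f zero) _ _))

sum-++ : ∀ {k m} (xs : Vector ℕ k) (ys : Vector ℕ m) → sum (xs ++ ys) ≡ sum xs + sum ys
sum-++ {k} {m} xs ys = trans (sum-↑ k m (xs ++ ys))
  (cong₂ _+_ (sum-cong-≗ (lookup-++ˡ xs ys)) (sum-cong-≗ (lookup-++ʳ xs ys)))

sum-tabulate : ∀ {n} (f : Vector ℕ n) → List.sum (tabulate f) ≡ sum f
sum-tabulate {zero}  f = refl
sum-tabulate {suc n} f = cong (f zero +_) (sum-tabulate (f ∘ suc))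

seqSum≡sum : ∀ {n} (d : Vector ℕ n) → seqSum d ≡ sum d
seqSum≡sum d = trans (cong List.sum (map-tabulate id d)) (sum-tabulate d)

sum≤pred : ∀ {k} (f : Vector ℕ k) (i : Fin k) → f i ≡ 0 → (∀ j → f j ≤ 1) → sum f ≤ k ∸ 1
sum≤pred {suc k} f i fi≡0 f≤1 = begin
  sum f                     ≡⟨ sum-remove f ⟩
  f i + sum (removeAt f i)  ≡⟨ cong (_+ sum (removeAt f i)) fi≡0 ⟩
  sum (removeAt f i)        ≤⟨ sum-mono-≤ (f≤1 ∘ punchIn i) ⟩
  sum (replicate k 1)       ≡⟨ sum-replicate k 1 ⟩
  k * 1                     ≡⟨ *-identityʳ k ⟩
  k                         ∎
  where open ≤-Reasoning

edge : ∀ {n} → SimpleGraph n → Fin n → Fin n → ℕ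
edge G i j = if adj G i j then 1 else 0

edge≤1 : ∀ {n} (G : SimpleGraph n) i j → edge G i j ≤ 1
edge≤1 G i j with adj G i j
... | true  = ≤-refl
... | false = z≤n

edge-sym : ∀ {n} (G : SimpleGraph n) i j → edge G i j ≡ edge G j i
edge-sym G i j = cong (if_then 1 else 0) (SimpleGraph.sym G i j)

edge-irrefl : ∀ {n} (G : SimpleGraph n) i → edge G i i ≡ 0
edge-irrefl G i = cong (if_then 1 else 0) (irrefl G i)

degree≡sum-edge : ∀ {n} (G : SimpleGraph n) i → degree G i ≡ sum (edge G i)
degree≡sum-edge G i = seqSum≡sum (edge G i)

module _ {k m : ℕ} (G : SimpleGraph (k + m)) where

  private
    within across : Fin k → ℕ
    within i = ∑[ i′ < k ] edge G (i ↑ˡ m) (i′ ↑ˡ m)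
    across i = ∑[ j < m ] edge G (i ↑ˡ m) (k ↑ʳ j)

    degree-split : ∀ v → degree G v ≡ ∑[ i < k ] edge G v (i ↑ˡ m) + ∑[ j < m ] edge G v (k ↑ʳ j)
    degree-split v = trans (degree≡sum-edge G v) (sum-↑ k m (edge G v))

    edges-into-prefix≤degree : ∀ v → ∑[ i < k ] edge G v (i ↑ˡ m) ≤ degree G v
    edges-into-prefix≤degree v = ≤-trans (m≤m+n _ _) (≤-reflexive (≡.sym (degree-split v)))

    within≤ : ∀ i → within i ≤ k ∸ 1
    within≤ i = sum≤pred _ i (edge-irrefl G (i ↑ˡ m)) (λ i′ → edge≤1 G _ _)

    ∑across≤ : sum across ≤ ∑[ j < m ] degree G (k ↑ʳ j)
    ∑across≤ = begin
      ∑[ i < k ] ∑[ j < m ] edge G (i ↑ˡ m) (k ↑ʳ j)  ≡⟨ ∑-comm (λ i j → edge G (i ↑ˡ m) (k ↑ʳ j)) ⟩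
      ∑[ j < m ] ∑[ i < k ] edge G (i ↑ˡ m) (k ↑ʳ j)  ≡⟨ sum-cong-≗ (λ j → sum-cong-≗ (λ i → edge-sym G (i ↑ˡ m) (k ↑ʳ j))) ⟩
      ∑[ j < m ] ∑[ i < k ] edge G (k ↑ʳ j) (i ↑ˡ m)  ≤⟨ sum-mono-≤ (edges-into-prefix≤degree ∘ (k ↑ʳ_)) ⟩
      ∑[ j < m ] degree G (k ↑ʳ j)                     ∎
      where open ≤-Reasoning

  ∑degree-↑ˡ≤ : ∑[ i < k ] degree G (i ↑ˡ m) ≤ k * (k ∸ 1) + ∑[ j < m ] degree G (k ↑ʳ j)
  ∑degree-↑ˡ≤ = begin
    ∑[ i < k ] degree G (i ↑ˡ m)                    ≡⟨ sum-cong-≗ (degree-split ∘ (_↑ˡ m)) ⟩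
    ∑[ i < k ] (within i + across i)                ≡⟨ ∑-distrib-+ within across ⟩
    sum within + sum across                         ≤⟨ +-mono-≤ (sum-mono-≤ within≤) ∑across≤ ⟩
    sum (replicate k (k ∸ 1)) + ∑[ j < m ] degree G (k ↑ʳ j)
                                                    ≡⟨ cong (_+ ∑[ j < m ] degree G (k ↑ʳ j)) (sum-replicate k (k ∸ 1)) ⟩
    k * (k ∸ 1) + ∑[ j < m ] degree G (k ↑ʳ j)      ∎
    where open ≤-Reasoning

graphic-++⇒sum≤ : ∀ {k m} (xs : Vector ℕ k) (ys : Vector ℕ m) → Graphic (xs ++ ys) →
                  sum xs ≤ k * (k ∸ 1) + sum ys
graphic-++⇒sum≤ {k} {m} xs ys (G , deg≡) = begin
  sum xs                                       ≡⟨ sum-cong-≗ (λ i → trans (≡.sym (lookup-++ˡ xs ys i)) (≡.sym (deg≡ _))) ⟩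
  ∑[ i < k ] degree G (i ↑ˡ m)                 ≤⟨ ∑degree-↑ˡ≤ {k} {m} G ⟩
  k * (k ∸ 1) + ∑[ j < m ] degree G (k ↑ʳ j)   ≡⟨ cong (k * (k ∸ 1) +_) (sum-cong-≗ (λ j → trans (deg≡ _) (lookup-++ʳ xs ys j))) ⟩
  k * (k ∸ 1) + sum ys                         ∎
  where open ≤-Reasoning

module _ {k m : ℕ} where

  private
    toℕ-inj₁ : ∀ {i : Fin (k + m)} {i′} → splitAt k i ≡ inj₁ i′ → toℕ i′ ≡ toℕ i
    toℕ-inj₁ {i′ = i′} eq = trans (≡.sym (toℕ-↑ˡ i′ m)) (cong toℕ (splitAt⁻¹-↑ˡ eq))

    toℕ-inj₂ : ∀ {i : Fin (k + m)} {i′} → splitAt k i ≡ inj₂ i′ → k + toℕ i′ ≡ toℕ i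
    toℕ-inj₂ {i′ = i′} eq = trans (≡.sym (toℕ-↑ʳ k i′)) (cong toℕ (splitAt⁻¹-↑ʳ eq))

  ++-all : ∀ {A : Set} (P : A → Set) (xs : Vector A k) (ys : Vector A m) →
           (∀ i → P (xs i)) → (∀ j → P (ys j)) → ∀ i → P ((xs ++ ys) i)
  ++-all P xs ys Pxs Pys i with splitAt k i
  ... | inj₁ i′ = Pxs i′
  ... | inj₂ j′ = Pys j′

  ++-nonIncreasing : ∀ {xs : Vector ℕ k} {ys : Vector ℕ m} →
                     NonIncreasing xs → NonIncreasing ys → (∀ i j → ys j ≤ xs i) →
                     NonIncreasing (xs ++ ys)
  ++-nonIncreasing xs↓ ys↓ ys≤xs i j i≤j with splitAt k i in eqᵢ | splitAt k j in eqⱼ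
  ... | inj₁ i′ | inj₁ j′ = xs↓ i′ j′ (subst₂ _≤_ (≡.sym (toℕ-inj₁ eqᵢ)) (≡.sym (toℕ-inj₁ eqⱼ)) i≤j)
  ... | inj₁ i′ | inj₂ j′ = ys≤xs i′ j′
  ... | inj₂ i′ | inj₁ j′ = contradiction
          (≤-trans (≤-trans (m≤m+n k (toℕ i′)) (≤-reflexive (toℕ-inj₂ eqᵢ))) i≤j)
          (<⇒≱ (subst (_< k) (toℕ-inj₁ eqⱼ) (toℕ<n j′)))
  ... | inj₂ i′ | inj₂ j′ = ys↓ i′ j′
          (+-cancelˡ-≤ k _ _ (subst₂ _≤_ (≡.sym (toℕ-inj₂ eqᵢ)) (≡.sym (toℕ-inj₂ eqⱼ)) i≤j))

replicate-nonIncreasing : ∀ n x → NonIncreasing (replicate n x)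
replicate-nonIncreasing n x i j i≤j = ≤-refl

2∣m+m%2 : ∀ m → 2 ∣ m + m % 2
2∣m+m%2 m = divides (m / 2 + m % 2) (begin
  m + m % 2                  ≡⟨ cong (_+ m % 2) (m≡m%n+[m/n]*n m 2) ⟩
  m % 2 + m / 2 * 2 + m % 2  ≡⟨ regroup (m % 2) (m / 2) ⟩
  (m / 2 + m % 2) * 2        ∎)
  where
  open ≡.≡-Reasoning
  regroup : ∀ r q → r + q * 2 + r ≡ (q + r) * 2
  regroup = solve-∀

m<n+o⇒m*n≤n*[n∸1]+m*o : ∀ c k m → c < k + m → c * k ≤ k * (k ∸ 1) + c * m
m<n+o⇒m*n≤n*[n∸1]+m*o c zero m _ = ≤-trans (≤-reflexive (*-zeroʳ c)) z≤n
m<n+o⇒m*n≤n*[n∸1]+m*o c (suc k) m c<k+m with c ≤? k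
... | yes c≤k = begin
  c * suc k          ≤⟨ *-monoˡ-≤ (suc k) c≤k ⟩
  k * suc k          ≡⟨ *-comm k (suc k) ⟩
  suc k * k          ≤⟨ m≤m+n (suc k * k) (c * m) ⟩
  suc k * k + c * m  ∎
  where open ≤-Reasoning
... | no c≰k with m≤n⇒∃[o]m+o≡n (≰⇒> c≰k)
... | t , refl with m≤n⇒∃[o]m+o≡n (+-cancelˡ-< (suc k) t m c<k+m)
... | u , refl = ≤-trans (m≤m+n _ _) (≤-reflexive (expand k t u))
  where
  expand : ∀ k t u → (suc k + t) * suc k + (suc k * u + t * t + t * u + t)
                     ≡ suc k * k + (suc k + t) * (suc t + u)
  expand = solve-∀

staircase : ∀ k m → ℕ → ℕ → ℕ → Vector ℕ (k + suc m)
staircase k m a b c = replicate k a ++ (replicate 1 b ++ replicate m c)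

seqSum-staircase : ∀ k m a b c → seqSum (staircase k m a b c) ≡ k * a + (b + m * c)
seqSum-staircase k m a b c = begin
  seqSum (staircase k m a b c)                     ≡⟨ seqSum≡sum (staircase k m a b c) ⟩
  sum (staircase k m a b c)                        ≡⟨ sum-++ (replicate k a) (replicate 1 b ++ replicate m c) ⟩
  sum (replicate k a) + (b + sum (replicate m c))  ≡⟨ cong₂ (λ x y → x + (b + y)) (sum-replicate k a) (sum-replicate m c) ⟩
  k * a + (b + m * c)                              ∎
  where open ≡.≡-Reasoning

staircase-∈𝒟 : ∀ k m {a b c} → c ≤ b → b ≤ a → 2 ∣ k * a + (b + m * c) →
               InD (k + suc m) a c (staircase k m a b c)
staircase-∈𝒟 k m {a} {b} {c} c≤b b≤a 2∣sum =
    ++-nonIncreasing (replicate-nonIncreasing k a)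
      (++-nonIncreasing (replicate-nonIncreasing 1 b) (replicate-nonIncreasing m c) (λ _ _ → c≤b))
      (λ _ → tail≤a)
  , ++-all (_≤ a) (replicate k a) tail (λ _ → ≤-refl) tail≤a
  , ++-all (c ≤_) (replicate k a) tail (λ _ → ≤-trans c≤b b≤a) c≤tail
  , subst (2 ∣_) (≡.sym (seqSum-staircase k m a b c)) 2∣sum
  where
  tail : Vector ℕ (suc m)
  tail = replicate 1 b ++ replicate m c

  tail≤a : ∀ j → tail j ≤ a
  tail≤a = ++-all (_≤ a) (replicate 1 b) (replicate m c) (λ _ → b≤a) (λ _ → ≤-trans c≤b b≤a)

  c≤tail : ∀ j → c ≤ tail j
  c≤tail = ++-all (c ≤_) (replicate 1 b) (replicate m c) (λ _ → c≤b) (λ _ → ≤-refl)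

allGraphic⇒bound : ∀ {c₁ c₂} k m → c₂ < c₁ → (∀ d → InD (k + suc m) c₁ c₂ d → Graphic d) →
                   c₁ * k ≤ k * (k ∸ 1) + c₂ * suc m + 1
allGraphic⇒bound {c₁} {c₂} k m c₂<c₁ allGraphic = begin
  c₁ * k                                ≡⟨ *-comm c₁ k ⟩
  k * c₁                                ≡⟨ sum-replicate k c₁ ⟨
  sum (replicate k c₁)                  ≤⟨ graphic-++⇒sum≤ (replicate k c₁) _ (allGraphic _ d∈𝒟) ⟩
  k * (k ∸ 1) + (c₂ + e + sum (replicate m c₂))
                                        ≡⟨ cong (λ x → k * (k ∸ 1) + (c₂ + e + x)) (sum-replicate m c₂) ⟩
  k * (k ∸ 1) + (c₂ + e + m * c₂)       ≡⟨ regroup (k * (k ∸ 1)) c₂ e m ⟩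
  k * (k ∸ 1) + c₂ * suc m + e          ≤⟨ +-monoʳ-≤ _ e≤1 ⟩
  k * (k ∸ 1) + c₂ * suc m + 1          ∎
  where
  open ≤-Reasoning
  regroup : ∀ x c e m → x + (c + e + m * c) ≡ x + c * suc m + e
  regroup = solve-∀

  S : ℕ
  S = k * c₁ + c₂ * suc m

  e : ℕ
  e = S % 2

  e≤1 : e ≤ 1
  e≤1 = ≤-pred (m%n<n S 2)

  d∈𝒟 : InD (k + suc m) c₁ c₂ (staircase k m c₁ (c₂ + e) c₂)
  d∈𝒟 = staircase-∈𝒟 k m (m≤m+n c₂ e) (≤-trans (+-monoʳ-≤ c₂ e≤1) (≤-trans (≤-reflexive (+-comm c₂ 1)) c₂<c₁))
          (subst (2 ∣_) (≡.sym (regroup (k * c₁) c₂ e m)) (2∣m+m%2 S))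

c₁<k+m⇒bound : ∀ {c₁ c₂} k m → c₁ < k + m → c₁ * m ≡ c₂ * m → c₁ * k ≤ k * (k ∸ 1) + c₂ * m + 1
c₁<k+m⇒bound {c₁} {c₂} k m c₁<k+m c₁m≡c₂m = begin
  c₁ * k                        ≤⟨ m<n+o⇒m*n≤n*[n∸1]+m*o c₁ k m c₁<k+m ⟩
  k * (k ∸ 1) + c₁ * m          ≡⟨ cong (k * (k ∸ 1) +_) c₁m≡c₂m ⟩
  k * (k ∸ 1) + c₂ * m          ≤⟨ m≤m+n _ 1 ⟩
  k * (k ∸ 1) + c₂ * m + 1      ∎
  where open ≤-Reasoning

lemma2p9 : (n c₁ c₂ : ℕ) → c₂ ≤ c₁ → c₁ < n →
    ((d : Fin n → ℕ) → InD n c₁ c₂ d → Graphic d) →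
    (k : ℕ) → 1 ≤ k → k ≤ n →
    c₁ * k ≤ k * (k ∸ 1) + c₂ * (n ∸ k) + 1
lemma2p9 n c₁ c₂ c₂≤c₁ c₁<n allGraphic k _ k≤n
  with n ∸ k | m+[n∸m]≡n k≤n | m≤n⇒m<n∨m≡n c₂≤c₁
... | suc m | refl | inj₁ c₂<c₁ = allGraphic⇒bound k m c₂<c₁ allGraphic
... | suc m | refl | inj₂ refl  = c₁<k+m⇒bound {c₂ = c₁} k (suc m) c₁<n refl
... | zero  | refl | _          = c₁<k+m⇒bound {c₂ = c₂} k 0 c₁<n (trans (*-zeroʳ c₁) (≡.sym (*-zeroʳ c₂)))
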